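{- Let $n\in\mathbb N$ and let $c$ be a metric-like cost function on $\mathbb R^2$. For $\pi=(n_1,\dots,n_k)\in\mathscr P_1(n)$: (1) The following are equivalent: (a) the $n_i$ are not all mutually distinct; (b) there is $\sigma\in Perm(k)\setminus\{\mathrm{Id}\}$ with $\nu_\pi=\nu_\pi^\sigma$; (c) there is $\sigma\in Perm(k)\setminus\{\mathrm{Id}\}$ with $C(\nu_\pi,\nu_\pi^\sigma)=0$. (2) The following are equivalent: (a) the $n_i$ are mutually distinct; (b) for all $\sigma\in Perm(k)\setminus\{\mathrm{Id}\}$, $\nu_\pi\neq\nu_\pi^\sigma$; (c) for all $\sigma\in Perm(k)\setminus\{\mathrm{Id}\}$, $C(\nu_\pi,\nu_\pi^\sigma)\neq0$.
   Context: $\mathscr P_1(n)$ is the set of tuples $(n_1,\dots,n_k)$ of integers with $n\ge n_1\ge\dots\ge n_k\ge1$ and $\sum n_i=n$. $Perm(k)$ is the permutation group of $\{1,\dots,k\}$. For $\sigma\in Perm(k)$ define $\nu_\pi^\sigma:=\sum_{i=1}^k\sum_{\alpha=1}^{n_i}\delta_{(\sigma(i),\alpha)}$ (unit point masses in $\mathbb R^2$) and $\nu_\pi:=\nu_\pi^{\mathrm{Id}}$. A measurable cost $c$ is metric-like if $c\ge0$ with $c(x,y)=0$ iff $x=y$, $c$ symmetric, and $c$ satisfies the triangle inequality. For measures $\mu^-,\mu^+$ which are sums of $n$ unit point masses at distinct points, $C(\mu^-,\mu^+)$ is the minimum of $\sum_{z\in\operatorname{spt}\mu^- }c(z,g(z))$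 over bijections $g:\operatorname{spt}\mu^-\to\operatorname{spt}\mu^+$. -}

module Defs where

open import Data.Nat using (ℕ; zero; suc; _≤_; _≟_)
open import Data.Nat.ListAction using (sum)
open import Data.Fin using (Fin; toℕ)
open import Data.Fin.Permutation using (Permutation′; _⟨$⟩ʳ_)
open import Data.List using (List; []; _∷_; length; lookup; map; concatMap; allFin; upTo; filter)
open import Data.List.Relation.Unary.Unique.Propositional using (Unique)
open import Data.Product using (_×_; _,_; Σ; ∃)
open import Relation.Binary.PropositionalEquality using (_≡_; _≢_)
open import Relation.Binary.Structures using (IsTotalOrder)
open import Relation.Nullary using (¬_)
open import Data.Product.Properties using (≡-dec)
open import Function.Bundles using (_↔_; Inverse)

-- Points.  All measures in the statement are supported on the integer
-- lattice points (σ(i), α) with i, α ≥ 1; we take as ambient point set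
-- the lattice ℕ × ℕ ⊆ ℝ².

Point : Set
Point = ℕ × ℕ

_≟ᵖ_ : (p q : Point) → Relation.Nullary.Dec (p ≡ q)
_≟ᵖ_ = ≡-dec _≟_ _≟_

-- Values of a cost function: an (abstract) totally ordered commutative
-- monoid whose order is translation invariant.  [0,∞) ⊆ ℝ with + and ≤
-- is an instance.

record CostValues : Set₁ where
  infixl 6 _+_
  infix 4 _≤ᵥ_
  field
    Carrier      : Set
    0#           : Carrier
    _+_          : Carrier → Carrier → Carrier
    _≤ᵥ_         : Carrier → Carrier → Set
    isTotalOrder : IsTotalOrder _≡_ _≤ᵥ_
    +-assoc      : ∀ x y z → (x + y) + z ≡ x + (y + z)
    +-comm       : ∀ x y → x + y ≡ y + x
    +-identityˡ  : ∀ x → 0# + x ≡ x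
    +-monoˡ-≤    : ∀ {x y} z → x ≤ᵥ y → x + z ≤ᵥ y + z

module _ (V : CostValues) where
  open CostValues V

  record MetricLike (c : Point → Point → Carrier) : Set where
    field
      nonneg   : ∀ x y → 0# ≤ᵥ c x y
      zero-iff : ∀ x y → (c x y ≡ 0# → x ≡ y) × (x ≡ y → c x y ≡ 0#)
      symm     : ∀ x y → c x y ≡ c y x
      triangle : ∀ x y z → c x z ≤ᵥ c x y + c y z

  ∑ : ∀ {m} → (Fin m → Carrier) → Carrier
  ∑ {zero}  f = 0#
  ∑ {suc m} f = f Fin.zero + ∑ (λ j → f (Fin.suc j))

  -- A sum of unit point masses at distinct points is represented by the
  -- list of its (distinct) support points.  A bijection between the
  -- supports is a bijection between the index sets of the two lists.
  transportCost : (c : Point → Point → Carrier) (μ⁻ μ⁺ : List Point) →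
                  (Fin (length μ⁻) ↔ Fin (length μ⁺)) → Carrier
  transportCost c μ⁻ μ⁺ g = ∑ (λ j → c (lookup μ⁻ j) (lookup μ⁺ (Inverse.to g j)))

  OptimalCostIs : (c : Point → Point → Carrier) (μ⁻ μ⁺ : List Point) → Carrier → Set
  OptimalCostIs c μ⁻ μ⁺ x =
    (Σ (Fin (length μ⁻) ↔ Fin (length μ⁺)) λ g → transportCost c μ⁻ μ⁺ g ≡ x) ×
    (∀ g → x ≤ᵥ transportCost c μ⁻ μ⁺ g)

-- Partitions in 𝒫₁(n): k parts n₁ ≥ … ≥ n_k ≥ 1 (indexed by Fin k) with
-- Σ nᵢ = n  (n ≥ n₁ then follows).

InP₁ : (n k : ℕ) → (Fin k → ℕ) → Set
InP₁ n k ns =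
  (∀ i → 1 ≤ ns i) ×
  (∀ i j → toℕ i ≤ toℕ j → ns j ≤ ns i) ×
  (sum (map ns (allFin k)) ≡ n)

MutuallyDistinct : ∀ {k} → (Fin k → ℕ) → Set
MutuallyDistinct ns = ∀ i j → ns i ≡ ns j → i ≡ j

IsNotId : ∀ {k} → Permutation′ k → Set
IsNotId σ = ¬ (∀ i → σ ⟨$⟩ʳ i ≡ i)

-- Support of ν_π^σ = Σ_i Σ_{α=1}^{n_i} δ_{(σ(i), α)}, listed; the
-- coordinate σ(i) ∈ {1,…,k} is  suc (toℕ (σ i)).
νpts : ∀ {k} → (Fin k → ℕ) → Permutation′ k → List Point
νpts {k} ns σ =
  concatMap (λ i → map (λ α → (suc (toℕ (σ ⟨$⟩ʳ i)) , suc α)) (upTo (ns i))) (allFin k)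

mass : List Point → Point → ℕ
mass μ p = length (filter (λ q → q ≟ᵖ p) μ)

_≈ᵐ_ : List Point → List Point → Set
μ ≈ᵐ μ' = ∀ p → mass μ p ≡ mass μ' p

idPerm : ∀ k → Permutation′ k
idPerm k = Data.Fin.Permutation.id

{-# OPTIONS --safe #-}
-- ν_π^σ consists of distinct lattice points, the column above σ(i) holding the n_i points
-- (σ(i), 1), …, (σ(i), n_i).  So ν_π = ν_π^σ, and likewise C(ν_π, ν_π^σ) = 0 (a zero-cost
-- bijection of the supports moves no point), both say exactly that n_{σ(i)} = n_i for all i,
-- i.e. σ only permutes equal parts among themselves.  A permutation σ ≠ Id with this property
-- exists iff two parts are equal: transpose them.
module Submission where

open import Defs
open import Data.Nat as ℕ using (ℕ; suc; _<_; _≤_; z≤n; s≤s)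
open import Data.Nat.Properties using (suc-injective; ≤-antisym; ≮⇒≥; n≮n)
open import Data.Fin as F using (Fin; toℕ)
open import Data.Fin.Properties using (toℕ-injective; any?)
open import Data.Fin.Permutation using (Permutation′; _⟨$⟩ʳ_; _⟨$⟩ˡ_; inverseʳ; inverseˡ; transpose)
import Data.Fin.Permutation.Components as Components
open import Data.List using (List; _∷_; length; lookup; map; concat; concatMap; allFin; upTo)
open import Data.List.Properties using (concatMap-cong; map-∘)
open import Data.List.Membership.Propositional using (_∈_)
open import Data.List.Membership.Propositional.Properties
  using (∈-map⁺; ∈-map⁻; ∈-concatMap⁺; ∈-concatMap⁻; ∈-upTo⁺; ∈-upTo⁻; ∈-allFin; ∈-lookup)
open import Data.List.Membership.Propositional.Properties.WithK using (unique∧set⇒bag)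
open import Data.List.Relation.Binary.Subset.Propositional using (_⊆_)
open import Data.List.Relation.Binary.BagAndSetEquality using (_∼[_]_; bag; >>=-cong; ∼bag⇒↭)
open import Data.List.Relation.Binary.Permutation.Propositional using (_↭_; ↭⇒↭ₛ)
open import Data.List.Relation.Binary.Permutation.Propositional.Properties using (↭-length; filter-↭)
import Data.List.Relation.Binary.Permutation.Setoid as PermutationSetoid
open import Data.List.Relation.Binary.Permutation.Setoid.Properties using (onIndices-lookup)
open import Data.List.Relation.Unary.Any as Any using (here; there)
open import Data.List.Relation.Unary.Any.Properties using (lookup-index)
import Data.List.Relation.Unary.Unique.Propositional.Properties as Unique
open import Data.Product using (_×_; _,_; Σ; ∃₂; proj₁; proj₂)
open import Function using (_∘_)
open import Function.Related.Propositional using (K-refl)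
open import Function.Bundles using (_⇔_; mk⇔; _↔_; Inverse; Equivalence)
open import Function.Properties.Equivalence using () renaming (trans to ⇔-trans; sym to ⇔-sym)
open import Relation.Binary.PropositionalEquality
open import Relation.Binary.Structures using (IsTotalOrder)
open import Relation.Nullary using (¬_; Dec; yes; no)
open import Relation.Nullary.Decidable using (¬?; _×-dec_; decidable-stable)
open import Data.Empty using (⊥-elim)

mass-pos⇒∈ : ∀ (μ : List Point) {p} → 0 < mass μ p → p ∈ μ
mass-pos⇒∈ (q ∷ μ) {p} pos with q ≟ᵖ p
... | yes q≡p = here (sym q≡p)
... | no _    = there (mass-pos⇒∈ μ pos)

∈⇒mass-pos : ∀ {μ : List Point} {p} → p ∈ μ → 0 < mass μ p
∈⇒mass-pos {q ∷ μ} {p} p∈ with q ≟ᵖ p | p∈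
... | yes _   | _         = s≤s z≤n
... | no q≢p  | here p≡q  = ⊥-elim (q≢p (sym p≡q))
... | no _    | there p∈μ = ∈⇒mass-pos p∈μ

≈ᵐ⇒⊆ : ∀ {μ μ′} → μ ≈ᵐ μ′ → μ ⊆ μ′
≈ᵐ⇒⊆ {μ′ = μ′} μ≈μ′ {p} p∈μ = mass-pos⇒∈ μ′ (subst (0 <_) (μ≈μ′ p) (∈⇒mass-pos p∈μ))

↭⇒≈ᵐ : ∀ {μ μ′} → μ ↭ μ′ → μ ≈ᵐ μ′
↭⇒≈ᵐ μ↭μ′ p = ↭-length (filter-↭ (_≟ᵖ p) μ↭μ′)

module _ (V : CostValues) where
  open CostValues V
  open IsTotalOrder isTotalOrder using (antisym) renaming (refl to ≤ᵥ-refl; trans to ≤ᵥ-trans)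

  ∑-cong : ∀ {m} {f g : Fin m → Carrier} → (∀ j → f j ≡ g j) → ∑ V f ≡ ∑ V g
  ∑-cong {ℕ.zero} f≗g = refl
  ∑-cong {suc m}  f≗g = cong₂ _+_ (f≗g F.zero) (∑-cong (f≗g ∘ F.suc))

  ∑-zero : ∀ m → ∑ V {m} (λ _ → 0#) ≡ 0#
  ∑-zero ℕ.zero  = refl
  ∑-zero (suc m) = trans (cong (0# +_) (∑-zero m)) (+-identityˡ 0#)

  ∑-nonneg : ∀ {m} {f : Fin m → Carrier} → (∀ j → 0# ≤ᵥ f j) → 0# ≤ᵥ ∑ V f
  ∑-nonneg {ℕ.zero} f≥0 = ≤ᵥ-refl
  ∑-nonneg {suc m} {f} f≥0 =
    ≤ᵥ-trans (∑-nonneg (f≥0 ∘ F.suc))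
             (subst (_≤ᵥ f F.zero + ∑ V (f ∘ F.suc)) (+-identityˡ _) (+-monoˡ-≤ _ (f≥0 F.zero)))

  ∑≡0⇒≡0 : ∀ {m} {f : Fin m → Carrier} → (∀ j → 0# ≤ᵥ f j) → ∑ V f ≡ 0# → ∀ j → f j ≡ 0#
  ∑≡0⇒≡0 {suc m} {f} f≥0 ∑≡0 = λ { F.zero → head≡0 ; (F.suc j) → ∑≡0⇒≡0 (f≥0 ∘ F.suc) tail≡0 j }
    where
    tail : Carrier
    tail = ∑ V (f ∘ F.suc)

    head≤0 : f F.zero ≤ᵥ 0#
    head≤0 = subst₂ _≤ᵥ_ (+-identityˡ _) (trans (+-comm _ _) ∑≡0)
                         (+-monoˡ-≤ (f F.zero) (∑-nonneg (f≥0 ∘ F.suc)))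

    head≡0 : f F.zero ≡ 0#
    head≡0 = antisym head≤0 (f≥0 F.zero)

    tail≡0 : tail ≡ 0#
    tail≡0 = trans (sym (+-identityˡ tail)) (trans (cong (_+ tail) (sym head≡0)) ∑≡0)

  module _ {c : Point → Point → Carrier} (metric : MetricLike V c) where
    open MetricLike metric

    ↭⇒optimalCost0 : ∀ {μ μ′} → μ ↭ μ′ → OptimalCostIs V c μ μ′ 0#
    ↭⇒optimalCost0 {μ} {μ′} μ↭μ′ =
      (g , cost≡0) , λ h → ∑-nonneg (λ j → nonneg (lookup μ j) (lookup μ′ (Inverse.to h j)))
      where
      μ↭ₛμ′ : PermutationSetoid._↭_ (setoid Point) μ μ′
      μ↭ₛμ′ = ↭⇒↭ₛ μ↭μ′

      g : Fin (length μ) ↔ Fin (length μ′)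
      g = PermutationSetoid.onIndices μ↭ₛμ′

      cost≡0 : transportCost V c μ μ′ g ≡ 0#
      cost≡0 = trans (∑-cong (λ j → proj₂ (zero-iff _ _) (onIndices-lookup (setoid Point) μ↭ₛμ′ j)))
                     (∑-zero (length μ))

    zeroCost⇒lookup≡ : ∀ μ μ′ g → transportCost V c μ μ′ g ≡ 0# →
                       ∀ j → lookup μ j ≡ lookup μ′ (Inverse.to g j)
    zeroCost⇒lookup≡ μ μ′ g cost≡0 j =
      proj₁ (zero-iff _ _) (∑≡0⇒≡0 (λ j → nonneg (lookup μ j) (lookup μ′ (Inverse.to g j))) cost≡0 j)

    optimalCost0⇒⊆ : ∀ {μ μ′} → OptimalCostIs V c μ μ′ 0# → μ ⊆ μ′
    optimalCost0⇒⊆ {μ} {μ′} ((g , cost≡0) , _) p∈μ =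
      subst (_∈ μ′) (sym (trans (lookup-index p∈μ) (zeroCost⇒lookup≡ μ μ′ g cost≡0 _)))
            (∈-lookup (Inverse.to g (Any.index p∈μ)))

    optimalCost0⇒⊇ : ∀ {μ μ′} → OptimalCostIs V c μ μ′ 0# → μ′ ⊆ μ
    optimalCost0⇒⊇ {μ} {μ′} ((g , cost≡0) , _) p∈μ′ =
      subst (_∈ μ) (trans (zeroCost⇒lookup≡ μ μ′ g cost≡0 _)
                          (trans (cong (lookup μ′) (Inverse.strictlyInverseˡ g _)) (sym (lookup-index p∈μ′))))
            (∈-lookup (Inverse.from g (Any.index p∈μ′)))

module _ {k : ℕ} (σ : Permutation′ k) where

  ⟨$⟩ʳ-injective : ∀ {i j} → σ ⟨$⟩ʳ i ≡ σ ⟨$⟩ʳ j → i ≡ j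
  ⟨$⟩ʳ-injective σi≡σj = trans (sym (inverseˡ σ)) (trans (cong (σ ⟨$⟩ˡ_) σi≡σj) (inverseˡ σ))

  allFin∼[bag]map : allFin k ∼[ bag ] map (σ ⟨$⟩ʳ_) (allFin k)
  allFin∼[bag]map = unique∧set⇒bag (Unique.allFin⁺ k) (Unique.map⁺ ⟨$⟩ʳ-injective (Unique.allFin⁺ k))
    λ {i} → mk⇔ (λ _ → subst (_∈ map (σ ⟨$⟩ʳ_) (allFin k)) (inverseʳ σ)
                                (∈-map⁺ (σ ⟨$⟩ʳ_) (∈-allFin (σ ⟨$⟩ˡ i))))
                (λ _ → ∈-allFin i)

  concatMap-allFin-reindex : ∀ {A : Set} (f : Fin k → List A) →
                             concatMap f (allFin k) ↭ concatMap (f ∘ (σ ⟨$⟩ʳ_)) (allFin k)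
  concatMap-allFin-reindex f =
    ∼bag⇒↭ (subst (concatMap f (allFin k) ∼[ bag ]_) (cong concat (sym (map-∘ (allFin k))))
                  (>>=-cong allFin∼[bag]map (λ _ → K-refl)))

transpose-isNotId : ∀ {k} {i j : Fin k} → i ≢ j → IsNotId (transpose i j)
transpose-isNotId {i = i} {j} i≢j transpose≗id = i≢j (trans (sym (transpose≗id i)) transpose-i≡j)
  where
  transpose-i≡j : Components.transpose i j i ≡ j
  transpose-i≡j with i F.≟ i
  ... | yes _   = refl
  ... | no i≢i  = ⊥-elim (i≢i refl)

point : ∀ {k} → Fin k → ℕ → Point
point j α = suc (toℕ j) , suc α

point-injective : ∀ {k} {i j : Fin k} {α β} → point i α ≡ point j β → i ≡ j × α ≡ β
point-injective p≡q = toℕ-injective (suc-injective (cong proj₁ p≡q)) , suc-injective (cong proj₂ p≡q)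

Stabilises : ∀ {k} → Permutation′ k → (Fin k → ℕ) → Set
Stabilises σ ns = ∀ i → ns (σ ⟨$⟩ʳ i) ≡ ns i

module _ {k : ℕ} (ns : Fin k → ℕ) where

  column : Permutation′ k → Fin k → List Point
  column σ i = map (point (σ ⟨$⟩ʳ i)) (upTo (ns i))

  point∈νpts⁺ : ∀ σ {j α} → α < ns (σ ⟨$⟩ˡ j) → point j α ∈ νpts ns σ
  point∈νpts⁺ σ {j} {α} α< =
    subst (λ j′ → point j′ α ∈ νpts ns σ) (inverseʳ σ)
          (∈-concatMap⁺ (column σ)
             (Any.map (λ { refl → ∈-map⁺ (point _) (∈-upTo⁺ α<) }) (∈-allFin (σ ⟨$⟩ˡ j))))

  point∈νpts⁻ : ∀ σ {j α} → point j α ∈ νpts ns σ → α < ns (σ ⟨$⟩ˡ j)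
  point∈νpts⁻ σ {j} {α} p∈ with Any.satisfied (∈-concatMap⁻ (column σ) {xs = allFin k} p∈)
  ... | i , p∈column with ∈-map⁻ (point (σ ⟨$⟩ʳ i)) p∈column
  ... | β , β∈ , p≡ with point-injective p≡
  ... | refl , refl = subst (λ i′ → α < ns i′) (sym (inverseˡ σ)) (∈-upTo⁻ β∈)

  νpts-⊆⇒≤ : ∀ σ τ → νpts ns σ ⊆ νpts ns τ → ∀ j → ns (σ ⟨$⟩ˡ j) ≤ ns (τ ⟨$⟩ˡ j)
  νpts-⊆⇒≤ σ τ σ⊆τ j = ≮⇒≥ λ τ<σ → n≮n _ (point∈νpts⁻ τ (σ⊆τ (point∈νpts⁺ σ τ<σ)))

  νpts-⊆⊇⇒stabilises : ∀ σ → νpts ns (idPerm k) ⊆ νpts ns σ → νpts ns σ ⊆ νpts ns (idPerm k) →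
                       Stabilises σ ns
  νpts-⊆⊇⇒stabilises σ id⊆σ σ⊆id i =
    trans (≤-antisym (νpts-⊆⇒≤ (idPerm k) σ id⊆σ (σ ⟨$⟩ʳ i)) (νpts-⊆⇒≤ σ (idPerm k) σ⊆id (σ ⟨$⟩ʳ i)))
          (cong ns (inverseˡ σ))

  stabilises⇒νpts↭ : ∀ σ → Stabilises σ ns → νpts ns (idPerm k) ↭ νpts ns σ
  stabilises⇒νpts↭ σ stab =
    subst (νpts ns (idPerm k) ↭_) (concatMap-cong (λ i → cong (map _ ∘ upTo) (stab i)) (allFin k))
          (concatMap-allFin-reindex σ (column (idPerm k)))

  ≈ᵐ⇔stabilises : ∀ σ → (νpts ns (idPerm k) ≈ᵐ νpts ns σ) ⇔ Stabilises σ ns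
  ≈ᵐ⇔stabilises σ = mk⇔
    (λ ν≈νσ → νpts-⊆⊇⇒stabilises σ (≈ᵐ⇒⊆ ν≈νσ) (≈ᵐ⇒⊆ (sym ∘ ν≈νσ)))
    (↭⇒≈ᵐ ∘ stabilises⇒νpts↭ σ)

  optimalCost0⇔stabilises : ∀ V {c} → MetricLike V c → ∀ σ →
                            OptimalCostIs V c (νpts ns (idPerm k)) (νpts ns σ) (CostValues.0# V) ⇔ Stabilises σ ns
  optimalCost0⇔stabilises V metric σ = mk⇔
    (λ cost≡0 → νpts-⊆⊇⇒stabilises σ (optimalCost0⇒⊆ V metric cost≡0) (optimalCost0⇒⊇ V metric cost≡0))
    (↭⇒optimalCost0 V metric ∘ stabilises⇒νpts↭ σ)

  transpose-stabilises : ∀ {i j} → ns i ≡ ns j → Stabilises (transpose i j) ns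
  transpose-stabilises {i} {j} nsi≡nsj m with m F.≟ i
  ... | yes refl = sym nsi≡nsj
  ... | no _ with m F.≟ j
  ...   | yes refl = nsi≡nsj
  ...   | no _     = refl

  Collision : Set
  Collision = ∃₂ λ i j → i ≢ j × ns i ≡ ns j

  collision? : Dec Collision
  collision? = any? λ i → any? λ j → ¬? (i F.≟ j) ×-dec (ns i ℕ.≟ ns j)

  ¬distinct⇒collision : ¬ MutuallyDistinct ns → Collision
  ¬distinct⇒collision ¬distinct = decidable-stable collision? λ ¬collision →
    ¬distinct λ i j nsi≡nsj → decidable-stable (i F.≟ j) λ i≢j → ¬collision (i , j , i≢j , nsi≡nsj)

  distinct⇒trivialStabiliser : MutuallyDistinct ns → ∀ σ → IsNotId σ → ¬ Stabilises σ ns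
  distinct⇒trivialStabiliser distinct σ σ≢id stab = σ≢id λ i → distinct _ _ (stab i)

  ¬distinct⇔nontrivialStabiliser : (¬ MutuallyDistinct ns) ⇔ (Σ (Permutation′ k) λ σ → IsNotId σ × Stabilises σ ns)
  ¬distinct⇔nontrivialStabiliser = mk⇔
    (λ ¬distinct → let i , j , i≢j , nsi≡nsj = ¬distinct⇒collision ¬distinct in
                   transpose i j , transpose-isNotId i≢j , transpose-stabilises nsi≡nsj)
    (λ { (σ , σ≢id , stab) distinct → distinct⇒trivialStabiliser distinct σ σ≢id stab })

  distinct⇔trivialStabiliser : MutuallyDistinct ns ⇔ (∀ σ → IsNotId σ → ¬ Stabilises σ ns)
  distinct⇔trivialStabiliser = mk⇔
    distinct⇒trivialStabiliser
    (λ trivial i j nsi≡nsj → decidable-stable (i F.≟ j) λ i≢j →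
       trivial (transpose i j) (transpose-isNotId i≢j) (transpose-stabilises nsi≡nsj))

module _ {k : ℕ} {P Q : Permutation′ k → Set} (P⇔Q : ∀ σ → P σ ⇔ Q σ) where

  nontrivial-∃-cong : (Σ (Permutation′ k) λ σ → IsNotId σ × P σ) ⇔ (Σ (Permutation′ k) λ σ → IsNotId σ × Q σ)
  nontrivial-∃-cong = mk⇔ (λ { (σ , σ≢id , p) → σ , σ≢id , Equivalence.to (P⇔Q σ) p })
                          (λ { (σ , σ≢id , q) → σ , σ≢id , Equivalence.from (P⇔Q σ) q })

  nontrivial-∀¬-cong : (∀ σ → IsNotId σ → ¬ P σ) ⇔ (∀ σ → IsNotId σ → ¬ Q σ)
  nontrivial-∀¬-cong = mk⇔ (λ ¬P σ σ≢id → ¬P σ σ≢id ∘ Equivalence.from (P⇔Q σ))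
                           (λ ¬Q σ σ≢id → ¬Q σ σ≢id ∘ Equivalence.to (P⇔Q σ))

proposition4p8 : (n : ℕ) (V : CostValues) (c : Point → Point → CostValues.Carrier V) →
    MetricLike V c →
    (k : ℕ) (ns : Fin k → ℕ) → InP₁ n k ns →
    -- (1)
    ((¬ MutuallyDistinct ns) ⇔ (Σ (Permutation′ k) λ σ → IsNotId σ × (νpts ns (idPerm k) ≈ᵐ νpts ns σ))) ×
    ((Σ (Permutation′ k) λ σ → IsNotId σ × (νpts ns (idPerm k) ≈ᵐ νpts ns σ)) ⇔ (Σ (Permutation′ k) λ σ → IsNotId σ × OptimalCostIs V c (νpts ns (idPerm k)) (νpts ns σ) (CostValues.0# V))) ×
    -- (2)
    (MutuallyDistinct ns ⇔ (∀ (σ : Permutation′ k) → IsNotId σ → ¬ (νpts ns (idPerm k) ≈ᵐ νpts ns σ))) ×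
    ((∀ (σ : Permutation′ k) → IsNotId σ → ¬ (νpts ns (idPerm k) ≈ᵐ νpts ns σ)) ⇔ (∀ (σ : Permutation′ k) → IsNotId σ → ¬ OptimalCostIs V c (νpts ns (idPerm k)) (νpts ns σ) (CostValues.0# V)))
proposition4p8 n V c metric k ns _ =
    ⇔-trans (¬distinct⇔nontrivialStabiliser ns) (⇔-sym (nontrivial-∃-cong ≈ᵐ⇔stab))
  , ⇔-trans (nontrivial-∃-cong ≈ᵐ⇔stab) (⇔-sym (nontrivial-∃-cong cost0⇔stab))
  , ⇔-trans (distinct⇔trivialStabiliser ns) (⇔-sym (nontrivial-∀¬-cong ≈ᵐ⇔stab))
  , ⇔-trans (nontrivial-∀¬-cong ≈ᵐ⇔stab) (⇔-sym (nontrivial-∀¬-cong cost0⇔stab))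
  where
  ≈ᵐ⇔stab : ∀ σ → (νpts ns (idPerm k) ≈ᵐ νpts ns σ) ⇔ Stabilises σ ns
  ≈ᵐ⇔stab = ≈ᵐ⇔stabilises ns

  cost0⇔stab : ∀ σ → OptimalCostIs V c (νpts ns (idPerm k)) (νpts ns σ) (CostValues.0# V) ⇔ Stabilises σ ns
  cost0⇔stab = optimalCost0⇔stabilises ns V metric
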